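{- Let $e_1,e_2,e_3$ be nonzero numbers with $e_1+e_2+e_3=0$, and let $a,b,c$ satisfy $e_1a^2+e_2b^2+e_3c^2=0$ and $(a+b)(b+c)(c+a)\neq0$. Then, identically in $x,y,z$, $$(ax+by+cz)(x+y+z)-\tfrac12(a+b)(b+c)(c+a)\Big(\frac{x}{b+c}+\frac{y}{c+a}+\frac{z}{a+b}\Big)^2=\tfrac12(e_1a+e_2b+e_3c)\Big(\frac{x^2}{e_1}+\frac{y^2}{e_2}+\frac{z^2}{e_3}\Big).$$ -}

module Defs where

open import Level using (Level; _⊔_) renaming (suc to lsuc)
open import Algebra.Bundles using (CommutativeRing)
open import Data.Nat using (ℕ; zero; suc)
open import Relation.Binary.PropositionalEquality using (_≡_)
open import Relation.Nullary using (¬_)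

record Field (c ℓ : Level) : Set (lsuc (c ⊔ ℓ)) where
  field
    commutativeRing : CommutativeRing c ℓ
  open CommutativeRing commutativeRing public
  field
    0≉1      : ¬ (0# ≈ 1#)
    inv      : (x : Carrier) → ¬ (x ≈ 0#) → Carrier
    *-inv    : (x : Carrier) (p : ¬ (x ≈ 0#)) → x * inv x p ≈ 1#

  div : (x y : Carrier) → ¬ (y ≈ 0#) → Carrier
  div x y p = x * inv y p

  fromℕ : ℕ → Carrier
  fromℕ zero    = 0#
  fromℕ (suc n) = 1# + fromℕ n

  nz-left : {x y : Carrier} → ¬ (x * y ≈ 0#) → ¬ (x ≈ 0#)
  nz-left {x} {y} h x≈0 = h (trans (*-congʳ x≈0) (zeroˡ y))

  nz-right : {x y : Carrier} → ¬ (x * y ≈ 0#) → ¬ (y ≈ 0#)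
  nz-right {x} {y} h y≈0 = h (trans (*-congˡ y≈0) (zeroʳ x))

CharZero : ∀ {c ℓ} → Field c ℓ → Set ℓ
CharZero F = ∀ (n : ℕ) → fromℕ n ≈ 0# → n ≡ 0
  where open Field F

two≉0 : ∀ {c ℓ} (F : Field c ℓ) → CharZero F → ¬ (Field._≈_ F (Field.fromℕ F 2) (Field.0# F))
two≉0 F ch h with ch 2 h
... | ()

module Submission where

-- Both sides are quadratic forms in x, y, z, so it suffices to compare coefficients. With
-- P = (a + b)(b + c)(c + a), the xy coefficient of ½P(x/(b + c) + y/(c + a) + z/(a + b))² is
-- P/((b + c)(c + a)) = a + b, as in (ax + by + cz)(x + y + z), and the right side has no cross
-- terms. For x², clearing the denominators 2, e₁ and b + c turns the claim into
-- 2ae₁(b + c) = e₁(c + a)(a + b) + (e₁a + e₂b + e₃c)(b + c), and the two sides differ by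
-- (e₁a² + e₂b² + e₃c²) + (e₁ + e₂ + e₃)bc = 0. The y² and z² cases follow by cyclic symmetry.

open import Algebra.Bundles using (CommutativeRing)
open import Defs
open import Level using (Level)
open import Relation.Nullary using (¬_)

-- Reciprocals enter as explicit witnesses (h for 1/2, p, q, r for 1/(b + c), 1/(c + a), 1/(a + b),
-- f, f₁, f₂, f₃ for 1/e₁, 1/e₂, 1/e₃), so the identity is proved in an arbitrary commutative ring.
module _ {c ℓ} (R : CommutativeRing c ℓ) where
  open CommutativeRing R
  open import Algebra.Properties.Group +-group using (quasigroup)
  open import Algebra.Properties.Quasigroup quasigroup using (x≈z//y)
  open import Algebra.Solver.Ring.NaturalCoefficients.Default commutativeSemiring
  open import Relation.Binary.Reasoning.Setoid setoid

  sum₃≈0-rotate : ∀ {u v w} → u + v + w ≈ 0# → v + w + u ≈ 0#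
  sum₃≈0-rotate {u} {v} {w} = trans (solve 3 (λ u v w → v :+ w :+ u := u :+ v :+ w) refl u v w)

  diagonal-identity : ∀ e₁ e₂ e₃ a b c →
    e₁ * (c + a) * (a + b) + (e₁ * a + e₂ * b + e₃ * c) * (b + c)
      ≈ (a + a) * e₁ * (b + c)
        + ((e₁ * (a * a) + e₂ * (b * b) + e₃ * (c * c)) + (e₁ + e₂ + e₃) * (b * c))
  diagonal-identity = solve 6 (λ e₁ e₂ e₃ a b c →
    e₁ :* (c :+ a) :* (a :+ b) :+ (e₁ :* a :+ e₂ :* b :+ e₃ :* c) :* (b :+ c)
      := (a :+ a) :* e₁ :* (b :+ c)
         :+ ((e₁ :* (a :* a) :+ e₂ :* (b :* b) :+ e₃ :* (c :* c)) :+ (e₁ :+ e₂ :+ e₃) :* (b :* c))) refl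

  diagonal-cleared : ∀ {e₁ e₂ e₃ a b c} →
    e₁ + e₂ + e₃ ≈ 0# → e₁ * (a * a) + e₂ * (b * b) + e₃ * (c * c) ≈ 0# →
    (a + a) * e₁ * (b + c) ≈ e₁ * (c + a) * (a + b) + (e₁ * a + e₂ * b + e₃ * c) * (b + c)
  diagonal-cleared {e₁} {e₂} {e₃} {a} {b} {c} sum≈0 quad≈0 = begin
    (a + a) * e₁ * (b + c)                         ≈⟨ +-identityʳ _ ⟨
    (a + a) * e₁ * (b + c) + 0#                    ≈⟨ +-congˡ remainder≈0 ⟨
    (a + a) * e₁ * (b + c) + (e₁ * (a * a) + e₂ * (b * b) + e₃ * (c * c) + (e₁ + e₂ + e₃) * (b * c))
                                                   ≈⟨ diagonal-identity e₁ e₂ e₃ a b c ⟨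
    e₁ * (c + a) * (a + b) + (e₁ * a + e₂ * b + e₃ * c) * (b + c) ∎
    where
    remainder≈0 : e₁ * (a * a) + e₂ * (b * b) + e₃ * (c * c) + (e₁ + e₂ + e₃) * (b * c) ≈ 0#
    remainder≈0 = begin
      e₁ * (a * a) + e₂ * (b * b) + e₃ * (c * c) + (e₁ + e₂ + e₃) * (b * c) ≈⟨ +-cong quad≈0 (*-congʳ sum≈0) ⟩
      0# + 0# * (b * c)                                                     ≈⟨ +-identityˡ _ ⟩
      0# * (b * c)                                                          ≈⟨ zeroˡ _ ⟩
      0#                                                                    ∎

  diagonal-coefficient : ∀ {e₁ e₂ e₃ a b c h p f} →
    h + h ≈ 1# → (b + c) * p ≈ 1# → e₁ * f ≈ 1# →
    e₁ + e₂ + e₃ ≈ 0# → e₁ * (a * a) + e₂ * (b * b) + e₃ * (c * c) ≈ 0# →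
    a ≈ h * ((a + b) * (b + c) * (c + a)) * (p * p) + h * (e₁ * a + e₂ * b + e₃ * c) * f
  diagonal-coefficient {e₁} {e₂} {e₃} {a} {b} {c} {h} {p} {f} half bp ef sum≈0 quad≈0 = begin
    a
      ≈⟨ solve 1 (λ a → a := a :* con 1 :* con 1 :* con 1 :* con 1) refl a ⟩
    a * 1# * 1# * 1# * 1#
      ≈⟨ *-cong (*-cong (*-cong (*-congˡ half) ef) bp) bp ⟨
    a * (h + h) * (e₁ * f) * ((b + c) * p) * ((b + c) * p)
      ≈⟨ solve 7 (λ e₁ a b c h p f →
           a :* (h :+ h) :* (e₁ :* f) :* ((b :+ c) :* p) :* ((b :+ c) :* p)
             := h :* f :* (p :* p) :* (b :+ c) :* ((a :+ a) :* e₁ :* (b :+ c))) refl e₁ a b c h p f ⟩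
    h * f * (p * p) * (b + c) * ((a + a) * e₁ * (b + c))
      ≈⟨ *-congˡ (diagonal-cleared sum≈0 quad≈0) ⟩
    h * f * (p * p) * (b + c) * (e₁ * (c + a) * (a + b) + E * (b + c))
      ≈⟨ solve 8 (λ e₁ a b c h p f E →
           h :* f :* (p :* p) :* (b :+ c) :* (e₁ :* (c :+ a) :* (a :+ b) :+ E :* (b :+ c))
             := h :* ((a :+ b) :* (b :+ c) :* (c :+ a)) :* (p :* p) :* (e₁ :* f)
                :+ h :* E :* f :* ((b :+ c) :* p) :* ((b :+ c) :* p)) refl e₁ a b c h p f E ⟩
    h * ((a + b) * (b + c) * (c + a)) * (p * p) * (e₁ * f) + h * E * f * ((b + c) * p) * ((b + c) * p)
      ≈⟨ +-cong (*-congˡ ef) (*-cong (*-congˡ bp) bp) ⟩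
    h * ((a + b) * (b + c) * (c + a)) * (p * p) * 1# + h * E * f * 1# * 1#
      ≈⟨ solve 7 (λ a b c h p f E →
           h :* ((a :+ b) :* (b :+ c) :* (c :+ a)) :* (p :* p) :* con 1 :+ h :* E :* f :* con 1 :* con 1
             := h :* ((a :+ b) :* (b :+ c) :* (c :+ a)) :* (p :* p) :+ h :* E :* f) refl a b c h p f E ⟩
    h * ((a + b) * (b + c) * (c + a)) * (p * p) + h * E * f ∎
    where
    E : Carrier
    E = e₁ * a + e₂ * b + e₃ * c

  cross-coefficient : ∀ {a b c h p q} → h + h ≈ 1# → (b + c) * p ≈ 1# → (c + a) * q ≈ 1# →
    a + b ≈ (h + h) * ((a + b) * (b + c) * (c + a)) * (p * q)
  cross-coefficient {a} {b} {c} {h} {p} {q} half bp cq = begin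
    a + b
      ≈⟨ solve 2 (λ a b → a :+ b := (a :+ b) :* con 1 :* con 1 :* con 1) refl a b ⟩
    (a + b) * 1# * 1# * 1#
      ≈⟨ *-cong (*-cong (*-congˡ half) bp) cq ⟨
    (a + b) * (h + h) * ((b + c) * p) * ((c + a) * q)
      ≈⟨ solve 6 (λ a b c h p q →
           (a :+ b) :* (h :+ h) :* ((b :+ c) :* p) :* ((c :+ a) :* q)
             := (h :+ h) :* ((a :+ b) :* (b :+ c) :* (c :+ a)) :* (p :* q)) refl a b c h p q ⟩
    (h + h) * ((a + b) * (b + c) * (c + a)) * (p * q) ∎

  quadratic-identity : ∀ {e₁ e₂ e₃ a b c h p q r f₁ f₂ f₃} →
    h + h ≈ 1# → (b + c) * p ≈ 1# → (c + a) * q ≈ 1# → (a + b) * r ≈ 1# →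
    e₁ * f₁ ≈ 1# → e₂ * f₂ ≈ 1# → e₃ * f₃ ≈ 1# →
    e₁ + e₂ + e₃ ≈ 0# → e₁ * (a * a) + e₂ * (b * b) + e₃ * (c * c) ≈ 0# →
    ∀ x y z →
    (a * x + b * y + c * z) * (x + y + z)
      - h * ((a + b) * (b + c) * (c + a)) * ((x * p + y * q + z * r) * (x * p + y * q + z * r))
      ≈ h * (e₁ * a + e₂ * b + e₃ * c) * (x * x * f₁ + y * y * f₂ + z * z * f₃)
  quadratic-identity {e₁} {e₂} {e₃} {a} {b} {c} {h} {p} {q} {r} {f₁} {f₂} {f₃}
                     half bp cq ar ef₁ ef₂ ef₃ sum≈0 quad≈0 x y z =
    sym (x≈z//y _ _ _ (begin
      h * (e₁ * a + e₂ * b + e₃ * c) * (x * x * f₁ + y * y * f₂ + z * z * f₃)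
        + h * ((a + b) * (b + c) * (c + a)) * ((x * p + y * q + z * r) * (x * p + y * q + z * r))
        ≈⟨ solve 16 (λ e₁ e₂ e₃ a b c h p q r f₁ f₂ f₃ x y z →
             h :* (e₁ :* a :+ e₂ :* b :+ e₃ :* c) :* (x :* x :* f₁ :+ y :* y :* f₂ :+ z :* z :* f₃)
               :+ h :* ((a :+ b) :* (b :+ c) :* (c :+ a)) :* ((x :* p :+ y :* q :+ z :* r) :* (x :* p :+ y :* q :+ z :* r))
             := (h :* ((a :+ b) :* (b :+ c) :* (c :+ a)) :* (p :* p) :+ h :* (e₁ :* a :+ e₂ :* b :+ e₃ :* c) :* f₁) :* (x :* x)
               :+ (h :* ((b :+ c) :* (c :+ a) :* (a :+ b)) :* (q :* q) :+ h :* (e₂ :* b :+ e₃ :* c :+ e₁ :* a) :* f₂) :* (y :* y)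
               :+ (h :* ((c :+ a) :* (a :+ b) :* (b :+ c)) :* (r :* r) :+ h :* (e₃ :* c :+ e₁ :* a :+ e₂ :* b) :* f₃) :* (z :* z)
               :+ (h :+ h) :* ((a :+ b) :* (b :+ c) :* (c :+ a)) :* (p :* q) :* (x :* y)
               :+ (h :+ h) :* ((b :+ c) :* (c :+ a) :* (a :+ b)) :* (q :* r) :* (y :* z)
               :+ (h :+ h) :* ((c :+ a) :* (a :+ b) :* (b :+ c)) :* (r :* p) :* (z :* x)) refl
             e₁ e₂ e₃ a b c h p q r f₁ f₂ f₃ x y z ⟩
      (h * ((a + b) * (b + c) * (c + a)) * (p * p) + h * (e₁ * a + e₂ * b + e₃ * c) * f₁) * (x * x)
        + (h * ((b + c) * (c + a) * (a + b)) * (q * q) + h * (e₂ * b + e₃ * c + e₁ * a) * f₂) * (y * y)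
        + (h * ((c + a) * (a + b) * (b + c)) * (r * r) + h * (e₃ * c + e₁ * a + e₂ * b) * f₃) * (z * z)
        + (h + h) * ((a + b) * (b + c) * (c + a)) * (p * q) * (x * y)
        + (h + h) * ((b + c) * (c + a) * (a + b)) * (q * r) * (y * z)
        + (h + h) * ((c + a) * (a + b) * (b + c)) * (r * p) * (z * x)
        ≈⟨ +-cong (+-cong (+-cong (+-cong (+-cong
             (*-congʳ (diagonal-coefficient half bp ef₁ sum≈0 quad≈0))
             (*-congʳ (diagonal-coefficient half cq ef₂ sum≈0′ quad≈0′)))
             (*-congʳ (diagonal-coefficient half ar ef₃ sum≈0″ quad≈0″)))
             (*-congʳ (cross-coefficient half bp cq)))
             (*-congʳ (cross-coefficient half cq ar)))
             (*-congʳ (cross-coefficient half ar bp)) ⟨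
      a * (x * x) + b * (y * y) + c * (z * z) + (a + b) * (x * y) + (b + c) * (y * z) + (c + a) * (z * x)
        ≈⟨ solve 6 (λ a b c x y z →
             a :* (x :* x) :+ b :* (y :* y) :+ c :* (z :* z) :+ (a :+ b) :* (x :* y) :+ (b :+ c) :* (y :* z) :+ (c :+ a) :* (z :* x)
               := (a :* x :+ b :* y :+ c :* z) :* (x :+ y :+ z)) refl a b c x y z ⟩
      (a * x + b * y + c * z) * (x + y + z) ∎))
    where
    sum≈0′ : e₂ + e₃ + e₁ ≈ 0#
    sum≈0′ = sum₃≈0-rotate sum≈0
    sum≈0″ : e₃ + e₁ + e₂ ≈ 0#
    sum≈0″ = sum₃≈0-rotate sum≈0′
    quad≈0′ : e₂ * (b * b) + e₃ * (c * c) + e₁ * (a * a) ≈ 0#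
    quad≈0′ = sum₃≈0-rotate quad≈0
    quad≈0″ : e₃ * (c * c) + e₁ * (a * a) + e₂ * (b * b) ≈ 0#
    quad≈0″ = sum₃≈0-rotate quad≈0′

  2*h≈1⇒h+h≈1 : ∀ {h} → (1# + (1# + 0#)) * h ≈ 1# → h + h ≈ 1#
  2*h≈1⇒h+h≈1 {h} = trans (solve 1 (λ h → h :+ h := (con 1 :+ (con 1 :+ con 0)) :* h) refl h)

lemma2p9 : ∀ {ℓ₁ ℓ₂ : Level} (F : Field ℓ₁ ℓ₂) (ch : CharZero F) →
           let open Field F in
           (e₁ e₂ e₃ a b c : Carrier) →
           (h₁ : ¬ (e₁ ≈ 0#)) (h₂ : ¬ (e₂ ≈ 0#)) (h₃ : ¬ (e₃ ≈ 0#)) →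
           e₁ + e₂ + e₃ ≈ 0# →
           e₁ * (a * a) + e₂ * (b * b) + e₃ * (c * c) ≈ 0# →
           (hp : ¬ ((a + b) * (b + c) * (c + a) ≈ 0#)) →
           ∀ (x y z : Carrier) →
           (a * x + b * y + c * z) * (x + y + z)
             - inv (fromℕ 2) (two≉0 F ch) * ((a + b) * (b + c) * (c + a))
               * ((div x (b + c) (nz-right (nz-left hp))
                   + div y (c + a) (nz-right hp)
                   + div z (a + b) (nz-left (nz-left hp)))
                  * (div x (b + c) (nz-right (nz-left hp))
                   + div y (c + a) (nz-right hp)
                   + div z (a + b) (nz-left (nz-left hp))))
           ≈ inv (fromℕ 2) (two≉0 F ch) * (e₁ * a + e₂ * b + e₃ * c)
             * (div (x * x) e₁ h₁ + div (y * y) e₂ h₂ + div (z * z) e₃ h₃)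
lemma2p9 F ch e₁ e₂ e₃ a b c h₁ h₂ h₃ sum≈0 quad≈0 hp =
  quadratic-identity commutativeRing
    (2*h≈1⇒h+h≈1 commutativeRing (*-inv (fromℕ 2) (two≉0 F ch)))
    (*-inv (b + c) (nz-right (nz-left hp))) (*-inv (c + a) (nz-right hp)) (*-inv (a + b) (nz-left (nz-left hp)))
    (*-inv e₁ h₁) (*-inv e₂ h₂) (*-inv e₃ h₃) sum≈0 quad≈0
  where open Field F
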